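{- For any relational frame $(X,\vartriangleleft)$, the operation $\twoheadrightarrow_\vartriangleleft$ is a preconditional on $\mathfrak{L}(X,\vartriangleleft)$.
   Context: A relational frame is $(X,\vartriangleleft)$ with $X$ nonempty and $\vartriangleleft\subseteq X\times X$; write $y\vartriangleright x$ for $x\vartriangleleft y$. $c_\vartriangleleft(A)=\{x\mid\forall x'\vartriangleleft x\ \exists x''\vartriangleright x':x''\in A\}$; $\mathfrak{L}(X,\vartriangleleft)$ is the complete lattice of sets $A$ with $c_\vartriangleleft(A)=A$ ordered by inclusion (top $X$, meets are intersections, joins are $c_\vartriangleleft$ of unions). $A\twoheadrightarrow_\vartriangleleft B=\{x\in X\mid\forall y\vartriangleleft x\,(y\in A\Rightarrow\exists z\vartriangleright y:\ z\in A\cap B)\}$. A preconditional on a bounded lattice $L$ is a binary operation $\to$ such that for all $a,b,c$: (1) $1\to a\le a$; (2) $a\wedge b\le a\to b$; (3) $a\to b\le a\to(a\wedge b)$; (4) if $b\le a$ then $a\to(b\to c)\le b\to c$; (5) if $b\le c$ then $a\to b\le a\to c$. -}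

module Defs where

open import Level using (Level; _⊔_; suc)
open import Data.Product using (Σ; ∃; _×_; _,_; proj₁)

Subset : Set → Set₁
Subset X = X → Set

module Frame {X : Set} (_◁_ : X → X → Set) where

  _▷_ : X → X → Set
  y ▷ x = x ◁ y

  _⊆_ : Subset X → Subset X → Set
  A ⊆ B = ∀ x → A x → B x

  _∩_ : Subset X → Subset X → Subset X
  (A ∩ B) x = A x × B x

  full : Subset X
  full _ = Data.Unit.⊤ where import Data.Unit

  c : Subset X → Subset X
  c A x = ∀ x' → x' ◁ x → ∃ λ x'' → (x'' ▷ x') × A x''

  IsFixed : Subset X → Set
  IsFixed A = (c A ⊆ A) × (A ⊆ c A)

  L : Set₁
  L = Σ (Subset X) IsFixed

  _↠_ : Subset X → Subset X → Subset X
  (A ↠ B) x = ∀ y → y ◁ x → A y → ∃ λ z → (z ▷ y) × (A ∩ B) z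

  -- In 𝔏(X,◁): order is ⊆, top is X, meet is ∩ (intersection of fixed
  -- points is a fixed point).
  record IsPreconditionalOnL (_⇒_ : Subset X → Subset X → Subset X) : Set₁ where
    field
      closedOp : ∀ A B → IsFixed A → IsFixed B → IsFixed (A ⇒ B)
      ax1 : ∀ A → IsFixed A → (full ⇒ A) ⊆ A
      ax2 : ∀ A B → IsFixed A → IsFixed B → (A ∩ B) ⊆ (A ⇒ B)
      ax3 : ∀ A B → IsFixed A → IsFixed B → (A ⇒ B) ⊆ (A ⇒ (A ∩ B))
      ax4 : ∀ A B C → IsFixed A → IsFixed B → IsFixed C →
            B ⊆ A → (A ⇒ (B ⇒ C)) ⊆ (B ⇒ C)
      ax5 : ∀ A B C → IsFixed A → IsFixed B → IsFixed C →
            B ⊆ C → (A ⇒ B) ⊆ (A ⇒ C)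

{-# OPTIONS --safe #-}
module Submission where

open import Defs
open import Data.Product using (_,_; proj₁)
open import Data.Unit using (tt)

-- Every preconditional law except (1) holds for arbitrary subsets, not only
-- for c-closed ones: the witness z ▷ y is always either x itself or the one
-- supplied by the hypothesis.  Moreover A ↠ B is c-closed for any A and B,
-- because a point all of whose ◁-predecessors see a point of A ↠ B inherits
-- the defining property from that point.  Law (1) is where closedness is
-- used: full ↠ A unfolds to c A.

module Properties {X : Set} (_◁_ : X → X → Set) where
  open Frame _◁_

  c-inflationary : ∀ A → A ⊆ c A
  c-inflationary A x Ax x' x'◁x = x , x'◁x , Ax

  c-↠⊆↠ : ∀ A B → c (A ↠ B) ⊆ (A ↠ B)
  c-↠⊆↠ A B x h y y◁x Ay with h y y◁x
  ... | x'' , y◁x'' , x''∈A↠B = x''∈A↠B y y◁x'' Ay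

  ↠-isFixed : ∀ A B → IsFixed (A ↠ B)
  ↠-isFixed A B = c-↠⊆↠ A B , c-inflationary (A ↠ B)

  full↠⊆c : ∀ A → (full ↠ A) ⊆ c A
  full↠⊆c A x h x' x'◁x with h x' x'◁x tt
  ... | z , x'◁z , (_ , Az) = z , x'◁z , Az

  ∩⊆↠ : ∀ A B → (A ∩ B) ⊆ (A ↠ B)
  ∩⊆↠ A B x A∩Bx y y◁x _ = x , y◁x , A∩Bx

  ↠⊆↠-∩ : ∀ A B → (A ↠ B) ⊆ (A ↠ (A ∩ B))
  ↠⊆↠-∩ A B x h y y◁x Ay with h y y◁x Ay
  ... | z , y◁z , (Az , Bz) = z , y◁z , (Az , (Az , Bz))

  ↠-↠-⊆ : ∀ A B C → B ⊆ A → (A ↠ (B ↠ C)) ⊆ (B ↠ C)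
  ↠-↠-⊆ A B C B⊆A x h y y◁x By with h y y◁x (B⊆A y By)
  ... | z , y◁z , (_ , z∈B↠C) = z∈B↠C y y◁z By

  ↠-monoʳ : ∀ A B C → B ⊆ C → (A ↠ B) ⊆ (A ↠ C)
  ↠-monoʳ A B C B⊆C x h y y◁x Ay with h y y◁x Ay
  ... | z , y◁z , (Az , Bz) = z , y◁z , (Az , B⊆C z Bz)

proposition6p2 : (X : Set) → (_◁_ : X → X → Set) → X →
    Frame.IsPreconditionalOnL _◁_ (Frame._↠_ _◁_)
proposition6p2 X _◁_ _ = record
  { closedOp = λ A B _ _ → ↠-isFixed A B
  ; ax1 = λ A A-fixed x h → proj₁ A-fixed x (full↠⊆c A x h)
  ; ax2 = λ A B _ _ → ∩⊆↠ A B
  ; ax3 = λ A B _ _ → ↠⊆↠-∩ A B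
  ; ax4 = λ A B C _ _ _ → ↠-↠-⊆ A B C
  ; ax5 = λ A B C _ _ _ → ↠-monoʳ A B C
  }
  where open Properties _◁_
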